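{- For all integers $d > 0$ and $2 \leq k \leq w \leq n$, an $(n, d, k, w)$-system of grids exists.
   Context: For an interval $I\subseteq[n]$, $I[\colon\ell]$ is the set of its $\ell$ smallest elements (all of $I$ if $|I|<\ell$). An $(n,w)$-interval partition is a partition of $[n]$ into intervals $I_1,\dots,I_t$, each of size $w$ or $w+1$, with all elements of $I_i$ smaller than those of $I_j$ for $i<j$. For $2\le k\le w$, $d\ge1$, the $(n,d,k,w)$-grid induced by such a partition is $\{x\in[n]^d:\exists i\in[d],\ x_i\in\bigcup_j I_j[\colon k-1]\}$, and $\mathcal{G}(n,d,k,w)$ denotes the family of all such grids. An $(n,d,k,w)$-system of grids is a tuple $(G_0,\dots,G_r)$ with $r=\lfloor\log_2(n/w)\rfloor$ such that $G_i\in\mathcal{G}(n,d,k,\lfloor n/2^{r-i}\rfloor)$ for each $0\le i\le r$ and $G_0\supseteq G_1\supseteq\dots\supseteq G_r$ as subsets of $[n]^d$. -}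

module Defs where

open import Data.Nat using (ℕ; zero; suc; _+_; _*_; _∸_; _^_; _≤_; _<_)
open import Data.Nat.DivMod using (_/_)
open import Data.Nat.Properties using (m^n≢0)
open import Data.Nat.Logarithm using (⌊log₂_⌋)
open import Data.Fin using (Fin; toℕ; inject₁) renaming (suc to fsuc)
open import Data.List using (List; []; _∷_)
open import Data.Nat.ListAction using (sum)
open import Data.List.Relation.Unary.All using (All)
open import Data.Product using (Σ; ∃; _×_)
open import Data.Sum using (_⊎_)
open import Data.Empty using (⊥)
open import Relation.Binary.PropositionalEquality using (_≡_)

-- [n] = {1,…,n}.
-- An (n,w)-interval partition I₁,…,I_t of [n] into consecutive intervals
-- (ordered left to right) is determined by the list of sizes |I₁|,…,|I_t|:
-- I₁ = {1,…,|I₁|}, I₂ starts right after I₁ ends, etc.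
record IntervalPartition (n w : ℕ) : Set where
  field
    sizes      : List ℕ
    sizesOK    : All (λ s → s ≡ w ⊎ s ≡ suc w) sizes
    covers     : sum sizes ≡ n

-- InHeads ℓ start ss m : m lies in I[:ℓ] for some interval I of the
-- consecutive intervals with sizes ss, the first of which starts at 'start'.
-- I[:ℓ] = the ℓ smallest elements of I (all of I if |I| < ℓ).
InHeads : ℕ → ℕ → List ℕ → ℕ → Set
InHeads ℓ start []       m = ⊥
InHeads ℓ start (s ∷ ss) m =
  (start ≤ m × m < start + s × m < start + ℓ) ⊎ InHeads ℓ (start + s) ss m

InCube : (n d : ℕ) → (Fin d → ℕ) → Set
InCube n d x = (i : Fin d) → 1 ≤ x i × x i ≤ n

InGrid : {n w : ℕ} (d k : ℕ) → IntervalPartition n w → (Fin d → ℕ) → Set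
InGrid d k P x = ∃ λ (i : Fin d) → InHeads (k ∸ 1) 1 (IntervalPartition.sizes P) (x i)

_/2^_ : ℕ → ℕ → ℕ
n /2^ m = _/_ n (2 ^ m) {{m^n≢0 2 m}}

-- ⌊ n / w ⌋ for w ≥ 1 (value at w = 0 is irrelevant; set to 0)
_div_ : ℕ → ℕ → ℕ
n div zero    = 0
n div (suc w) = n / suc w

-- r = ⌊log₂(n/w)⌋  (= ⌊log₂ ⌊n/w⌋⌋ for positive integers n, w)
levels : ℕ → ℕ → ℕ
levels n w = ⌊log₂ (n div w) ⌋

record SystemOfGrids (n d k w : ℕ) : Set where
  field
    part   : (i : Fin (suc (levels n w))) →
             IntervalPartition n (n /2^ (levels n w ∸ toℕ i))
    nested : (i : Fin (levels n w)) (x : Fin d → ℕ) → InCube n d x →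
             InGrid d k (part (fsuc i)) x → InGrid d k (part (inject₁ i)) x

-- Start from the one-interval partition of [n] and halve every interval
-- r times, an interval of size s becoming consecutive intervals of sizes
-- ⌊s/2⌋ and ⌈s/2⌉.  After m rounds all sizes are ⌊n/2^m⌋ or ⌊n/2^m⌋+1, so
-- reading the rounds backwards gives partitions of the required widths.
-- Halving only adds heads: the first k-1 elements of an interval stay the
-- first k-1 elements of its left half, as long as that half has at least
-- k-1 elements, which holds because every width is at least w ≥ k.
module Submission where

open import Defs
open import Data.Nat.Base
  using (ℕ; zero; suc; _+_; _*_; _∸_; _^_; _≤_; z≤n; s≤s; ⌊_/2⌋; ⌈_/2⌉; NonZero; >-nonZero)
open import Data.Nat.Properties
open import Data.Nat.DivMod
  using (_/_; m/n≡1+[m∸n]/n; m/n/o≡m/[n*o]; n/1≡n; n/n≡1; m*n/n≡m; m/n*n≤m; /-monoˡ-≤; /-monoʳ-≤)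
open import Data.Nat.Logarithm using (⌊log₂_⌋; ⌊log₂⌊n/2⌋⌋≡⌊log₂n⌋∸1)
open import Data.Nat.ListAction using (sum)
open import Data.Fin using (Fin; toℕ; inject₁) renaming (suc to fsuc)
open import Data.Fin.Properties using (toℕ-inject₁; toℕ<n)
open import Data.List using (List; []; _∷_)
open import Data.List.Relation.Unary.All as All using (All; []; _∷_)
open import Data.Product using (_,_)
open import Data.Sum using (_⊎_; inj₁; inj₂)
open import Relation.Binary.PropositionalEquality

/-congʳ : ∀ m {n o} .{{_ : NonZero n}} .{{_ : NonZero o}} → n ≡ o → m / n ≡ m / o
/-congʳ m refl = refl

n/2≡⌊n/2⌋ : ∀ n → n / 2 ≡ ⌊ n /2⌋
n/2≡⌊n/2⌋ zero          = refl
n/2≡⌊n/2⌋ (suc zero)    = refl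
n/2≡⌊n/2⌋ (suc (suc n)) = trans (m/n≡1+[m∸n]/n {2 + n} {2} (s≤s (s≤s z≤n))) (cong suc (n/2≡⌊n/2⌋ n))

⌈n/2⌉≡⌊n/2⌋⊎1+⌊n/2⌋ : ∀ n → ⌈ n /2⌉ ≡ ⌊ n /2⌋ ⊎ ⌈ n /2⌉ ≡ suc ⌊ n /2⌋
⌈n/2⌉≡⌊n/2⌋⊎1+⌊n/2⌋ zero          = inj₁ refl
⌈n/2⌉≡⌊n/2⌋⊎1+⌊n/2⌋ (suc zero)    = inj₂ refl
⌈n/2⌉≡⌊n/2⌋⊎1+⌊n/2⌋ (suc (suc n)) with ⌈n/2⌉≡⌊n/2⌋⊎1+⌊n/2⌋ n
... | inj₁ eq = inj₁ (cong suc eq)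
... | inj₂ eq = inj₂ (cong suc eq)

2^⌊log₂n⌋≤n : ∀ n .{{_ : NonZero n}} → 2 ^ ⌊log₂ n ⌋ ≤ n
2^⌊log₂n⌋≤n n = 2^ℓ≤ ⌊log₂ n ⌋ n refl
  where
  2^ℓ≤ : ∀ ℓ m .{{_ : NonZero m}} → ⌊log₂ m ⌋ ≡ ℓ → 2 ^ ℓ ≤ m
  2^ℓ≤ zero    (suc m)       _  = s≤s z≤n
  2^ℓ≤ (suc ℓ) (suc (suc m)) eq = begin
    2 * 2 ^ ℓ         ≤⟨ *-monoʳ-≤ 2 (2^ℓ≤ ℓ h log-h) ⟩
    2 * h             ≡⟨ cong (h +_) (+-identityʳ h) ⟩
    h + h             ≤⟨ +-monoʳ-≤ h (⌊n/2⌋≤⌈n/2⌉ (2 + m)) ⟩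
    h + ⌈ 2 + m /2⌉   ≡⟨ ⌊n/2⌋+⌈n/2⌉≡n (2 + m) ⟩
    2 + m             ∎
    where
    open ≤-Reasoning
    h : ℕ
    h = ⌊ 2 + m /2⌋
    log-h : ⌊log₂ h ⌋ ≡ ℓ
    log-h = trans (⌊log₂⌊n/2⌋⌋≡⌊log₂n⌋∸1 (2 + m)) (cong (_∸ 1) eq)

/2^-suc : ∀ n m → n /2^ suc m ≡ ⌊ n /2^ m /2⌋
/2^-suc n m = begin
  n /2^ suc m                   ≡⟨ /-congʳ n {{_}} {{2^m*2≢0}} (*-comm 2 (2 ^ m)) ⟩
  _/_ n (2 ^ m * 2) {{2^m*2≢0}} ≡⟨ m/n/o≡m/[n*o] n (2 ^ m) 2 {{m^n≢0 2 m}} {{_}} {{2^m*2≢0}} ⟨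
  n /2^ m / 2                   ≡⟨ n/2≡⌊n/2⌋ (n /2^ m) ⟩
  ⌊ n /2^ m /2⌋                 ∎
  where
  open ≡-Reasoning
  2^m*2≢0 : NonZero (2 ^ m * 2)
  2^m*2≢0 = m*n≢0 (2 ^ m) 2 {{m^n≢0 2 m}}

/2^-antitone : ∀ n {m m′} → m ≤ m′ → n /2^ m′ ≤ n /2^ m
/2^-antitone n {m} {m′} m≤m′ = /-monoʳ-≤ n {{m^n≢0 2 m′}} {{m^n≢0 2 m}} (^-monoʳ-≤ 2 m≤m′)

≤/2^levels : ∀ {n w} .{{_ : NonZero w}} → w ≤ n → w ≤ n /2^ levels n w
≤/2^levels {n} {w@(suc _)} w≤n = begin
  w                                     ≡⟨ m*n/n≡m w (2 ^ r) {{2^r≢0}} ⟨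
  _/_ (w * 2 ^ r) (2 ^ r) {{2^r≢0}}     ≤⟨ /-monoˡ-≤ (2 ^ r) {{2^r≢0}} w*2^r≤n ⟩
  n /2^ r                               ∎
  where
  open ≤-Reasoning
  r : ℕ
  r = levels n w
  2^r≢0 : NonZero (2 ^ r)
  2^r≢0 = m^n≢0 2 r
  n/w≢0 : NonZero (n / w)
  n/w≢0 = >-nonZero (subst (_≤ n / w) (n/n≡1 w) (/-monoˡ-≤ w w≤n))
  w*2^r≤n : w * 2 ^ r ≤ n
  w*2^r≤n = begin
    w * 2 ^ r    ≤⟨ *-monoʳ-≤ w (2^⌊log₂n⌋≤n (n / w) {{n/w≢0}}) ⟩
    w * (n / w)  ≡⟨ *-comm w (n / w) ⟩
    n / w * w    ≤⟨ m/n*n≤m n w ⟩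
    n            ∎

HasWidth : ℕ → ℕ → Set
HasWidth w s = s ≡ w ⊎ s ≡ suc w

halve : List ℕ → List ℕ
halve []       = []
halve (s ∷ ss) = ⌊ s /2⌋ ∷ ⌈ s /2⌉ ∷ halve ss

halve-width : ∀ {w ss} → All (HasWidth w) ss → All (HasWidth ⌊ w /2⌋) (halve ss)
halve-width     []               = []
halve-width {w} (inj₁ refl ∷ ws) = inj₁ refl ∷ ⌈n/2⌉≡⌊n/2⌋⊎1+⌊n/2⌋ w ∷ halve-width ws
halve-width {w} (inj₂ refl ∷ ws) = ⌈n/2⌉≡⌊n/2⌋⊎1+⌊n/2⌋ w ∷ inj₂ refl ∷ halve-width ws

sum-halve : ∀ ss → sum (halve ss) ≡ sum ss
sum-halve []       = refl
sum-halve (s ∷ ss) =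
  trans (sym (+-assoc ⌊ s /2⌋ ⌈ s /2⌉ _)) (cong₂ _+_ (⌊n/2⌋+⌈n/2⌉≡n s) (sum-halve ss))

InHeads-halve : ∀ {ℓ x} start ss → All (λ s → ℓ ≤ ⌊ s /2⌋) ss →
  InHeads ℓ start ss x → InHeads ℓ start (halve ss) x
InHeads-halve start (s ∷ ss) (ℓ≤ ∷ _) (inj₁ (start≤x , _ , x<start+ℓ)) =
  inj₁ (start≤x , <-≤-trans x<start+ℓ (+-monoʳ-≤ start ℓ≤) , x<start+ℓ)
InHeads-halve {ℓ} {x} start (s ∷ ss) (_ ∷ ℓ≤s) (inj₂ x∈heads) =
  inj₂ (inj₂ (subst (λ start′ → InHeads ℓ start′ (halve ss) x) start+s≡
    (InHeads-halve (start + s) ss ℓ≤s x∈heads)))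
  where
  start+s≡ : start + s ≡ start + ⌊ s /2⌋ + ⌈ s /2⌉
  start+s≡ = trans (cong (start +_) (sym (⌊n/2⌋+⌈n/2⌉≡n s))) (sym (+-assoc start _ _))

dyadicSizes : ℕ → ℕ → List ℕ
dyadicSizes n zero    = n ∷ []
dyadicSizes n (suc m) = halve (dyadicSizes n m)

dyadicSizes-width : ∀ n m → All (HasWidth (n /2^ m)) (dyadicSizes n m)
dyadicSizes-width n zero    = inj₁ (sym (n/1≡n n)) ∷ []
dyadicSizes-width n (suc m) rewrite /2^-suc n m = halve-width (dyadicSizes-width n m)

sum-dyadicSizes : ∀ n m → sum (dyadicSizes n m) ≡ n
sum-dyadicSizes n zero    = +-identityʳ n
sum-dyadicSizes n (suc m) = trans (sum-halve (dyadicSizes n m)) (sum-dyadicSizes n m)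

dyadicPartition : ∀ n m → IntervalPartition n (n /2^ m)
dyadicPartition n m = record
  { sizes   = dyadicSizes n m
  ; sizesOK = dyadicSizes-width n m
  ; covers  = sum-dyadicSizes n m
  }

InHeads-dyadicSizes-suc : ∀ {ℓ x} n m → ℓ ≤ n /2^ suc m →
  InHeads ℓ 1 (dyadicSizes n m) x → InHeads ℓ 1 (dyadicSizes n (suc m)) x
InHeads-dyadicSizes-suc {ℓ} n m ℓ≤ =
  InHeads-halve 1 (dyadicSizes n m) (All.map ℓ≤⌊s/2⌋ (dyadicSizes-width n m))
  where
  ℓ≤⌊w/2⌋ : ℓ ≤ ⌊ n /2^ m /2⌋
  ℓ≤⌊w/2⌋ = ≤-trans ℓ≤ (≤-reflexive (/2^-suc n m))
  ℓ≤⌊s/2⌋ : ∀ {s} → HasWidth (n /2^ m) s → ℓ ≤ ⌊ s /2⌋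
  ℓ≤⌊s/2⌋ (inj₁ refl) = ℓ≤⌊w/2⌋
  ℓ≤⌊s/2⌋ (inj₂ refl) = ≤-trans ℓ≤⌊w/2⌋ (⌊n/2⌋-mono (n≤1+n _))

lemma4 : (n d k w : ℕ) → 1 ≤ d → 2 ≤ k → k ≤ w → w ≤ n →
    SystemOfGrids n d k w
lemma4 n d (suc (suc _)) zero _ _ () _
lemma4 n d k w@(suc _) _ _ k≤w w≤n = record { part = part ; nested = nested }
  where
  r : ℕ
  r = levels n w
  part : (i : Fin (suc r)) → IntervalPartition n (n /2^ (r ∸ toℕ i))
  part i = dyadicPartition n (r ∸ toℕ i)
  k∸1≤ : ∀ {m} → m ≤ r → k ∸ 1 ≤ n /2^ m
  k∸1≤ m≤r = ≤-trans (m∸n≤m k 1) (≤-trans k≤w (≤-trans (≤/2^levels w≤n) (/2^-antitone n m≤r)))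
  nested : (i : Fin r) (x : Fin d → ℕ) → InCube n d x →
           InGrid d k (part (fsuc i)) x → InGrid d k (part (inject₁ i)) x
  nested i x _ (j , x∈heads) =
    j , subst (λ m → InHeads (k ∸ 1) 1 (dyadicSizes n m) (x j)) 1+coarse≡fine
          (InHeads-dyadicSizes-suc n coarse (k∸1≤ 1+coarse≤r) x∈heads)
    where
    coarse : ℕ
    coarse = r ∸ suc (toℕ i)
    1+coarse≡fine : suc coarse ≡ r ∸ toℕ (inject₁ i)
    1+coarse≡fine = trans (sym (+-∸-assoc 1 (toℕ<n i))) (cong (r ∸_) (sym (toℕ-inject₁ i)))
    1+coarse≤r : suc coarse ≤ r
    1+coarse≤r = ≤-trans (≤-reflexive 1+coarse≡fine) (m∸n≤m r (toℕ (inject₁ i)))
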